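{- Let $n\geq 3$ and let $K_n$ be the complete graph on $n$ vertices. Then $\chi_{td}(\mathrm{cl}(K_n)) \leq 2\chi_{td}(K_n)$.
   Context: For a graph $G$ and a positive integer $k$, a proper $k$-total difference labeling of $G$ is a function $f$ from $V(G)\cup E(G)$ to $\{1,2,\dots,k\}$ such that: (1) for every edge $\{u,v\}$, $f(\{u,v\})=|f(u)-f(v)|$; (2) adjacent vertices receive different labels; (3) two edges sharing a vertex receive different labels; (4) no edge receives the same label as one of its endpoints. $\chi_{td}(G)$ denotes the smallest $k$ for which $G$ has a proper $k$-total difference labeling. The clone $\mathrm{cl}(G)$ of a graph $G$ is the Cartesian product $G\square K_2$: two disjoint copies of $G$, with each vertex of the first copy joined by an edge to its corresponding vertex in the second copy. -}

module Defs where

open import Data.Nat using (ℕ; _≤_; _*_)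
open import Data.Fin using (Fin)
open import Data.Bool using (Bool)
open import Data.Product using (_×_; _,_; Σ)
open import Data.Sum using (_⊎_)
open import Relation.Binary.PropositionalEquality using (_≡_; _≢_)
open import Relation.Nullary using (¬_)

open import Data.Nat using (∣_-_∣) public

record Graph : Set₁ where
  field
    Vertex : Set
    Adj    : Vertex → Vertex → Set

open Graph public

K : ℕ → Graph
K n = record { Vertex = Fin n ; Adj = λ u v → u ≢ v }

-- Clone cl(G) = G □ K₂: vertices (v , copy); same copy & adjacent in G,
-- or same vertex & different copies.
cl : Graph → Graph
cl G = record
  { Vertex = Vertex G × Bool
  ; Adj    = λ { (u , a) (v , b) → (a ≡ b × Adj G u v) ⊎ (u ≡ v × a ≢ b) } }

-- A proper k-total difference labeling. The edge labels are forced by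
-- condition (1): f({u,v}) = ∣ f u - f v ∣, so only the vertex labels are data.
record ProperTDL (G : Graph) (k : ℕ) : Set where
  field
    f         : Vertex G → ℕ
    lower     : ∀ v → 1 ≤ f v
    upper     : ∀ v → f v ≤ k
    edgeLower : ∀ u v → Adj G u v → 1 ≤ ∣ f u - f v ∣
    edgeUpper : ∀ u v → Adj G u v → ∣ f u - f v ∣ ≤ k
    vtxProper : ∀ u v → Adj G u v → f u ≢ f v
    edgeProper : ∀ u v w → Adj G u v → Adj G u w → v ≢ w →
                 ∣ f u - f v ∣ ≢ ∣ f u - f w ∣
    incProper : ∀ u v → Adj G u v →
                (∣ f u - f v ∣ ≢ f u) × (∣ f u - f v ∣ ≢ f v)

IsChiTd : Graph → ℕ → Set
IsChiTd G k = ProperTDL G k × (∀ j → ProperTDL G j → k ≤ j)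

module Submission where

-- Given two proper k-TDLs f and g of G, label the first copy of G in cl G by 2f and the
-- second by 2g − 1. Edges inside a copy get the even labels 2∣f u − f v∣ and 2∣g u − g v∣,
-- so they inherit properness from f and g and never collide with the odd labels of the
-- rungs; the rung at u has label ∣2 f u − (2 g u − 1)∣, which differs from its odd end
-- exactly when f u ≠ 2 g u − 1. For K_n take g = f ∘ π, where π swaps the vertex labelled 1
-- (if any) with another vertex. This gives a proper 2k-TDL of cl K_n, and a least one exists
-- because properness of a labeling of a finite graph with labels in {1,…,k} is decidable.

open import Data.Bool using (Bool; true; false; not)
import Data.Bool.Properties as Bool
open import Data.Empty using (⊥-elim)
open import Data.Fin using (Fin; zero; suc)
open import Data.Fin.Permutation as Perm using (Permutation′; _⟨$⟩ʳ_)
import Data.Fin.Properties as Fin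
open import Data.Nat using (ℕ; zero; suc; pred; _+_; _∸_; _*_; _≤_; _<_; _<?_; z≤n; s≤s; s≤s⁻¹)
import Data.Nat as ℕ using (_≟_)
open import Data.Nat.Induction using (<-rec)
open import Data.Nat.Properties
  using ( suc-injective; +-identityʳ; +-suc; *-suc; *-cancelˡ-≡; *-monoʳ-≤; ≤-trans; ≤-total
        ; m≤m+n; n≤1+n; ≮⇒≥; <⇒≢; n≢0⇒n>0; m+1+n≢m; m∸n+n≡m; ∸-cancelˡ-≡; ⊔-lub; even≢odd
        ; ∣-∣-comm; *-distribˡ-∣-∣; ∣m-n∣≤m⊔n; ∣m-n∣≡0⇒m≡n; m≡n⇒∣m-n∣≡0
        ; m≤n⇒∣m-n∣≡n∸m; m≤n⇒∣n-m∣≡n∸m; anyUpTo? )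
open import Data.Product using (_×_; _,_; proj₁; proj₂; Σ; ∃)
open import Data.Product.Properties using (≡-dec)
open import Data.Sum using (_⊎_; inj₁; inj₂)
open import Data.Vec.Functional using ([]; _∷_; head; tail)
open import Function using (_∘_)
open import Function.Bundles using (Injection)
open import Function.Properties.Inverse using (↔⇒↣)
open import Relation.Binary.Definitions using (DecidableEquality)
open import Relation.Binary.PropositionalEquality
open import Relation.Nullary using (yes; no)
open import Relation.Nullary.Decidable
  using (Dec; map′; _×-dec_; _⊎-dec_; _→-dec_; ¬?; decidable-stable)
open import Defs
open ≡-Reasoning

Even Odd : ℕ → Set
Even n = ∃ λ m → n ≡ 2 * m
Odd  n = ∃ λ m → n ≡ suc (2 * m)

even-odd-≢ : ∀ {m n} → Even m → Odd n → m ≢ n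
even-odd-≢ (a , refl) (b , refl) = even≢odd a b

∣pred-pred∣ : ∀ {m n} → 0 < m → 0 < n → ∣ pred m - pred n ∣ ≡ ∣ m - n ∣
∣pred-pred∣ (s≤s _) (s≤s _) = refl

∣2m-[2n+1]∣-odd : ∀ m n → Odd ∣ 2 * m - suc (2 * n) ∣
∣2m-[2n+1]∣-odd zero    n       = n , refl
∣2m-[2n+1]∣-odd (suc m) zero    = m , cong ∣_- 1 ∣ (*-suc 2 m)
∣2m-[2n+1]∣-odd (suc m) (suc n) rewrite +-suc m (m + 0) | +-suc n (n + 0) = ∣2m-[2n+1]∣-odd m n

∣m-n∣≡n⇒m≡0⊎m≡2n : ∀ m n → ∣ m - n ∣ ≡ n → m ≡ 0 ⊎ m ≡ 2 * n
∣m-n∣≡n⇒m≡0⊎m≡2n m n eq with ≤-total m n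
... | inj₁ m≤n = inj₁ (∸-cancelˡ-≡ m≤n z≤n (trans (sym (m≤n⇒∣m-n∣≡n∸m m≤n)) eq))
... | inj₂ n≤m = inj₂ (begin
  m            ≡⟨ m∸n+n≡m n≤m ⟨
  (m ∸ n) + n  ≡⟨ cong (_+ n) (trans (sym (m≤n⇒∣n-m∣≡n∸m n≤m)) eq) ⟩
  n + n        ≡⟨ cong (n +_) (+-identityʳ n) ⟨
  2 * n        ∎)

suc[2*pred]≤2* : ∀ {m} → 0 < m → suc (2 * pred m) ≤ 2 * m
suc[2*pred]≤2* (s≤s {n = m} _) rewrite +-suc m (m + 0) = n≤1+n _

module _ {G : Graph} (f : Vertex G → ℕ) where

  VertexProper EdgeProper IncidenceProper : Set
  VertexProper    = ∀ u v → Adj G u v → f u ≢ f v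
  EdgeProper      = ∀ u v w → Adj G u v → Adj G u w → v ≢ w → ∣ f u - f v ∣ ≢ ∣ f u - f w ∣
  IncidenceProper = ∀ u v → Adj G u v → (∣ f u - f v ∣ ≢ f u) × (∣ f u - f v ∣ ≢ f v)

properTDL : ∀ {G k} (f : Vertex G → ℕ) → (∀ v → 0 < f v) → (∀ v → f v ≤ k) →
            VertexProper f → EdgeProper f → IncidenceProper f → ProperTDL G k
properTDL f lower upper vtx edge inc = record
  { f          = f
  ; lower      = lower
  ; upper      = upper
  ; edgeLower  = λ u v uv → n≢0⇒n>0 (vtx u v uv ∘ ∣m-n∣≡0⇒m≡n)
  ; edgeUpper  = λ u v _ → ≤-trans (∣m-n∣≤m⊔n (f u) (f v)) (⊔-lub (upper u) (upper v))
  ; vtxProper  = vtx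
  ; edgeProper = edge
  ; incProper  = inc
  }

pullback : ∀ {H G : Graph} {k} (φ : Vertex H → Vertex G) →
           (∀ {u v} → Adj H u v → Adj G (φ u) (φ v)) →
           (∀ {u v} → φ u ≡ φ v → u ≡ v) →
           ProperTDL G k → ProperTDL H k
pullback φ hom inj F = properTDL (f ∘ φ) (lower ∘ φ) (upper ∘ φ)
  (λ u v uv → vtxProper (φ u) (φ v) (hom uv))
  (λ u v w uv uw v≢w → edgeProper (φ u) (φ v) (φ w) (hom uv) (hom uw) (v≢w ∘ inj))
  (λ u v uv → incProper (φ u) (φ v) (hom uv))
  where open ProperTDL F

data CloneEdge (G : Graph) : Vertex (cl G) → Vertex (cl G) → Set where
  inCopy : ∀ {u v} b → Adj G u v → CloneEdge G (u , b) (v , b)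
  rung   : ∀ u b → CloneEdge G (u , b) (u , not b)

cloneEdge : ∀ {G} x y → Adj (cl G) x y → CloneEdge G x y
cloneEdge (u , a)     (v , .a)     (inj₁ (refl , uv))  = inCopy a uv
cloneEdge (u , true)  (.u , false) (inj₂ (refl , _))   = rung u true
cloneEdge (u , false) (.u , true)  (inj₂ (refl , _))   = rung u false
cloneEdge (u , true)  (.u , true)  (inj₂ (refl , t≢t)) = ⊥-elim (t≢t refl)
cloneEdge (u , false) (.u , false) (inj₂ (refl , f≢f)) = ⊥-elim (f≢f refl)

module CloneDoubling {G : Graph} {k : ℕ} (F H : ProperTDL G k)
  (gap : ∀ u → ProperTDL.f F u ≢ suc (2 * pred (ProperTDL.f H u))) where

  open ProperTDL using (f; lower; upper)

  copy : Bool → ProperTDL G k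
  copy true  = F
  copy false = H

  label : Vertex (cl G) → ℕ
  label (v , true)  = 2 * f F v
  label (v , false) = suc (2 * pred (f H v))  -- 2 · f H v − 1, without truncated subtraction

  label-true-even : ∀ u → Even (label (u , true))
  label-true-even u = f F u , refl

  label-false-odd : ∀ u → Odd (label (u , false))
  label-false-odd u = pred (f H u) , refl

  ∣label-inCopy∣ : ∀ b u v → ∣ label (u , b) - label (v , b) ∣ ≡ 2 * ∣ f (copy b) u - f (copy b) v ∣
  ∣label-inCopy∣ true  u v = sym (*-distribˡ-∣-∣ 2 (f F u) (f F v))
  ∣label-inCopy∣ false u v = trans (sym (*-distribˡ-∣-∣ 2 (pred (f H u)) (pred (f H v))))
                                   (cong (2 *_) (∣pred-pred∣ (lower H u) (lower H v)))

  ∣label-inCopy∣-even : ∀ b u v → Even ∣ label (u , b) - label (v , b) ∣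
  ∣label-inCopy∣-even b u v = ∣ f (copy b) u - f (copy b) v ∣ , ∣label-inCopy∣ b u v

  label-injective-inCopy : ∀ b {u v} → label (u , b) ≡ label (v , b) → f (copy b) u ≡ f (copy b) v
  label-injective-inCopy b {u} {v} eq = ∣m-n∣≡0⇒m≡n (*-cancelˡ-≡ _ 0 2 (begin
    2 * ∣ f (copy b) u - f (copy b) v ∣  ≡⟨ ∣label-inCopy∣ b u v ⟨
    ∣ label (u , b) - label (v , b) ∣    ≡⟨ m≡n⇒∣m-n∣≡0 eq ⟩
    0                                    ∎))

  ∣label-rung∣-odd : ∀ u b → Odd ∣ label (u , b) - label (u , not b) ∣
  ∣label-rung∣-odd u true  = ∣2m-[2n+1]∣-odd (f F u) (pred (f H u))
  ∣label-rung∣-odd u false = subst Odd (∣-∣-comm (label (u , true)) (label (u , false)))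
                                   (∣label-rung∣-odd u true)

  ∣label-rung∣≢label-false : ∀ u → ∣ label (u , true) - label (u , false) ∣ ≢ label (u , false)
  ∣label-rung∣≢label-false u eq with ∣m-n∣≡n⇒m≡0⊎m≡2n _ _ eq
  ... | inj₁ 2fu≡0      = <⇒≢ (lower F u) (sym (*-cancelˡ-≡ _ 0 2 2fu≡0))
  ... | inj₂ 2fu≡2label = gap u (*-cancelˡ-≡ _ _ 2 2fu≡2label)

  vertexProper : VertexProper label
  vertexProper x y xy with cloneEdge {G} x y xy
  ... | inCopy b uv  = ProperTDL.vtxProper (copy b) _ _ uv ∘ label-injective-inCopy b
  ... | rung u true  = even-odd-≢ (label-true-even u) (label-false-odd u)
  ... | rung u false = even-odd-≢ (label-true-even u) (label-false-odd u) ∘ sym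

  edgeProperAt : ∀ {x y z} → CloneEdge G x y → CloneEdge G x z → y ≢ z →
                 ∣ label x - label y ∣ ≢ ∣ label x - label z ∣
  edgeProperAt (inCopy b uv) (inCopy .b uw) y≢z eq =
    ProperTDL.edgeProper (copy b) _ _ _ uv uw (y≢z ∘ cong (_, b))
      (*-cancelˡ-≡ _ _ 2 (trans (sym (∣label-inCopy∣ b _ _)) (trans eq (∣label-inCopy∣ b _ _))))
  edgeProperAt (inCopy b _) (rung u .b) _ =
    even-odd-≢ (∣label-inCopy∣-even b _ _) (∣label-rung∣-odd u b)
  edgeProperAt (rung u b) (inCopy .b _) _ =
    even-odd-≢ (∣label-inCopy∣-even b _ _) (∣label-rung∣-odd u b) ∘ sym
  edgeProperAt (rung u b) (rung .u .b) y≢z = ⊥-elim (y≢z refl)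

  incidenceProperAt : ∀ {x y} → CloneEdge G x y →
                      (∣ label x - label y ∣ ≢ label x) × (∣ label x - label y ∣ ≢ label y)
  incidenceProperAt (inCopy true uv) =
      proj₁ (ProperTDL.incProper F _ _ uv) ∘ halve
    , proj₂ (ProperTDL.incProper F _ _ uv) ∘ halve
    where
    halve : ∀ {a} → ∣ label (_ , true) - label (_ , true) ∣ ≡ 2 * a → ∣ f F _ - f F _ ∣ ≡ a
    halve eq = *-cancelˡ-≡ _ _ 2 (trans (sym (∣label-inCopy∣ true _ _)) eq)
  incidenceProperAt (inCopy false _) =
      even-odd-≢ (∣label-inCopy∣-even false _ _) (label-false-odd _)
    , even-odd-≢ (∣label-inCopy∣-even false _ _) (label-false-odd _)
  incidenceProperAt (rung u true) =
      even-odd-≢ (label-true-even u) (∣label-rung∣-odd u true) ∘ sym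
    , ∣label-rung∣≢label-false u
  incidenceProperAt (rung u false) =
      ∣label-rung∣≢label-false u ∘ trans (∣-∣-comm (label (u , true)) (label (u , false)))
    , even-odd-≢ (label-true-even u) (∣label-rung∣-odd u false) ∘ sym

  label-positive : ∀ x → 0 < label x
  label-positive (v , true)  = ≤-trans (lower F v) (m≤m+n _ _)
  label-positive (v , false) = s≤s z≤n

  label-≤ : ∀ x → label x ≤ 2 * k
  label-≤ (v , true)  = *-monoʳ-≤ 2 (upper F v)
  label-≤ (v , false) = ≤-trans (suc[2*pred]≤2* (lower H v)) (*-monoʳ-≤ 2 (upper H v))

  cl-ProperTDL : ProperTDL (cl G) (2 * k)
  cl-ProperTDL = properTDL label label-positive label-≤ vertexProper
    (λ x y z xy xz → edgeProperAt (cloneEdge {G} x y xy) (cloneEdge {G} x z xz))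
    (λ x y xy → incidenceProperAt (cloneEdge {G} x y xy))

permute : ∀ {n k} → Permutation′ n → ProperTDL (K n) k → ProperTDL (K n) k
permute π = pullback (π ⟨$⟩ʳ_) (λ u≢v → u≢v ∘ π-injective) π-injective
  where
  π-injective : ∀ {u v} → π ⟨$⟩ʳ u ≡ π ⟨$⟩ʳ v → u ≡ v
  π-injective = Injection.injective (↔⇒↣ π)

labels-injective : ∀ {n k} (F : ProperTDL (K n) k) {u v} → ProperTDL.f F u ≡ ProperTDL.f F v → u ≡ v
labels-injective F {u} {v} eq = decidable-stable (u Fin.≟ v) (λ u≢v → ProperTDL.vtxProper F u v u≢v eq)

m≡suc[2*pred[m]]⇒m≡1 : ∀ {m} → m ≡ suc (2 * pred m) → m ≡ 1
m≡suc[2*pred[m]]⇒m≡1 {suc zero} _ = refl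
m≡suc[2*pred[m]]⇒m≡1 {suc (suc m)} eq = ⊥-elim (m+1+n≢m (suc m) (sym (suc-injective eq)))

1≡suc[2*pred[m]]⇒m≡1 : ∀ {m} → 0 < m → 1 ≡ suc (2 * pred m) → m ≡ 1
1≡suc[2*pred[m]]⇒m≡1 {suc zero} _ _ = refl
1≡suc[2*pred[m]]⇒m≡1 {suc (suc _)} _ ()

∃-other : ∀ {n} → 2 ≤ n → (v : Fin n) → ∃ λ u → u ≢ v
∃-other (s≤s (s≤s _)) zero    = suc zero , λ ()
∃-other (s≤s (s≤s _)) (suc _) = zero , λ ()

gap-permutation : ∀ {n} (f : Fin n → ℕ) → (∀ {u v} → f u ≡ f v → u ≡ v) → (∀ u → 0 < f u) →
                  2 ≤ n → ∃ λ (π : Permutation′ n) → ∀ u → f u ≢ suc (2 * pred (f (π ⟨$⟩ʳ u)))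
gap-permutation f inj pos 2≤n with Fin.any? (λ v → f v ℕ.≟ 1)
... | no ∄1 = Perm.id , λ u eq → ∄1 (u , m≡suc[2*pred[m]]⇒m≡1 eq)
... | yes (v₀ , fv₀≡1) with ∃-other 2≤n v₀
...   | u₁ , u₁≢v₀ = Perm.transpose v₀ u₁ , gap
  where
  only-v₀ : ∀ {u} → f u ≡ 1 → u ≡ v₀
  only-v₀ fu≡1 = inj (trans fu≡1 (sym fv₀≡1))
  gap : ∀ u → f u ≢ suc (2 * pred (f (Perm.transpose v₀ u₁ ⟨$⟩ʳ u)))
  gap u eq with u Fin.≟ v₀
  ... | yes refl = u₁≢v₀ (only-v₀ (1≡suc[2*pred[m]]⇒m≡1 (pos u₁) (trans (sym fv₀≡1) eq)))
  ... | no u≢v₀ with u Fin.≟ u₁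
  ...   | yes refl = u₁≢v₀ (only-v₀ (trans eq (cong (λ m → suc (2 * pred m)) fv₀≡1)))
  ...   | no _     = u≢v₀ (only-v₀ (m≡suc[2*pred[m]]⇒m≡1 eq))

Exhaustible : Set → Set₁
Exhaustible A = ∀ {P : A → Set} → (∀ x → Dec (P x)) → Dec (∀ x → P x)

exhaustible-Bool : Exhaustible Bool
exhaustible-Bool P? = map′ (λ { (t , _) true → t ; (_ , f) false → f }) (λ ∀P → ∀P true , ∀P false)
                           (P? true ×-dec P? false)

exhaustible-× : ∀ {A B} → Exhaustible A → Exhaustible B → Exhaustible (A × B)
exhaustible-× all-A? all-B? P? = map′ (λ ∀P (a , b) → ∀P a b) (λ ∀P a b → ∀P (a , b))
                                      (all-A? λ a → all-B? λ b → P? (a , b))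

BoundedSearch : Set → Set₁
BoundedSearch A = ∀ k {P : (A → ℕ) → Set} → (∀ {f g} → f ≗ g → P f → P g) → (∀ f → Dec (P f)) →
                  Dec (∃ λ f → (∀ a → f a ≤ k) × P f)

boundedSearch-Fin : ∀ n → BoundedSearch (Fin n)
boundedSearch-Fin zero k resp P? = map′ (λ p → [] , (λ ()) , p) (λ (_ , _ , p) → resp (λ ()) p) (P? [])
boundedSearch-Fin (suc n) k resp P? =
  map′ (λ (x , x<1+k , f , f≤k , p) → x ∷ f , (λ { zero → s≤s⁻¹ x<1+k ; (suc i) → f≤k i }) , p)
       (λ (f , f≤k , p) → head f , s≤s (f≤k zero) , tail f , f≤k ∘ suc
                        , resp (λ { zero → refl ; (suc _) → refl }) p)
       (anyUpTo? (λ x → boundedSearch-Fin n k (λ f≗g → resp (λ { zero → refl ; (suc i) → f≗g i }))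
                                                (λ f → P? (x ∷ f)))
                 (suc k))

onCopies : ∀ {A : Set} → (A → ℕ) → (A → ℕ) → A × Bool → ℕ
onCopies f g (a , true)  = f a
onCopies f g (a , false) = g a

boundedSearch-×Bool : ∀ {A} → BoundedSearch A → BoundedSearch (A × Bool)
boundedSearch-×Bool search k resp P? =
  map′ (λ (f , f≤k , g , g≤k , p) → onCopies f g , (λ { (a , true) → f≤k a ; (a , false) → g≤k a }) , p)
       (λ (h , h≤k , p) → h ∘ (_, true) , h≤k ∘ (_, true) , h ∘ (_, false) , h≤k ∘ (_, false)
                         , resp (λ { (_ , true) → refl ; (_ , false) → refl }) p)
       (search k (λ f≗f′ (g , g≤k , p) →
                    g , g≤k , resp (λ { (a , true) → f≗f′ a ; (_ , false) → refl }) p)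
                 (λ f → search k (λ g≗g′ → resp (λ { (_ , true) → refl ; (a , false) → g≗g′ a }))
                                 (λ g → P? (onCopies f g))))

record DecidableGraph (G : Graph) : Set₁ where
  field
    all?   : Exhaustible (Vertex G)
    search : BoundedSearch (Vertex G)
    _≟_    : DecidableEquality (Vertex G)
    adj?   : ∀ u v → Dec (Adj G u v)

K-decidable : ∀ n → DecidableGraph (K n)
K-decidable n = record
  { all?   = Fin.all?
  ; search = boundedSearch-Fin n
  ; _≟_    = Fin._≟_
  ; adj?   = λ u v → ¬? (u Fin.≟ v)
  }

cl-decidable : ∀ {G} → DecidableGraph G → DecidableGraph (cl G)
cl-decidable D = record
  { all?   = exhaustible-× all? exhaustible-Bool
  ; search = boundedSearch-×Bool search
  ; _≟_    = ≡-dec _≟_ Bool._≟_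
  ; adj?   = λ (u , a) (v , b) → ((a Bool.≟ b) ×-dec adj? u v) ⊎-dec ((u ≟ v) ×-dec ¬? (a Bool.≟ b))
  }
  where open DecidableGraph D

ProperLabeling : (G : Graph) → (Vertex G → ℕ) → Set
ProperLabeling G f = (∀ v → 0 < f v) × VertexProper {G} f × EdgeProper {G} f × IncidenceProper {G} f

properLabeling-resp-≗ : ∀ {G} {f g : Vertex G → ℕ} → f ≗ g → ProperLabeling G f → ProperLabeling G g
properLabeling-resp-≗ {f = f} {g} f≗g (pos , vtx , edge , inc) =
    (λ v → subst (0 <_) (f≗g v) (pos v))
  , (λ u v uv eq → vtx u v uv (trans (f≗g u) (trans eq (sym (f≗g v)))))
  , (λ u v w uv uw v≢w eq → edge u v w uv uw v≢w (trans (∣≗∣ u v) (trans eq (sym (∣≗∣ u w)))))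
  , (λ u v uv → (λ eq → proj₁ (inc u v uv) (trans (∣≗∣ u v) (trans eq (sym (f≗g u)))))
              , (λ eq → proj₂ (inc u v uv) (trans (∣≗∣ u v) (trans eq (sym (f≗g v))))))
  where
  ∣≗∣ : ∀ u v → ∣ f u - f v ∣ ≡ ∣ g u - g v ∣
  ∣≗∣ u v = cong₂ ∣_-_∣ (f≗g u) (f≗g v)

properLabeling? : ∀ {G} → DecidableGraph G → (f : Vertex G → ℕ) → Dec (ProperLabeling G f)
properLabeling? D f =
        all? (λ v → 0 <? f v)
  ×-dec all? (λ u → all? λ v → adj? u v →-dec ¬? (f u ℕ.≟ f v))
  ×-dec all? (λ u → all? λ v → all? λ w → adj? u v →-dec (adj? u w →-dec (¬? (v ≟ w) →-dec
          ¬? (∣ f u - f v ∣ ℕ.≟ ∣ f u - f w ∣))))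
  ×-dec all? (λ u → all? λ v → adj? u v →-dec
          (¬? (∣ f u - f v ∣ ℕ.≟ f u) ×-dec ¬? (∣ f u - f v ∣ ℕ.≟ f v)))
  where open DecidableGraph D

properTDL? : ∀ {G} → DecidableGraph G → ∀ k → Dec (ProperTDL G k)
properTDL? D k =
  map′ (λ (f , upper , pos , vtx , edge , inc) → properTDL f pos upper vtx edge inc)
       (λ F → let open ProperTDL F in f , upper , lower , vtxProper , edgeProper , incProper)
       (DecidableGraph.search D k properLabeling-resp-≗ (properLabeling? D))

Least : (ℕ → Set) → ℕ → Set
Least P d = P d × (∀ j → P j → d ≤ j)

least : ∀ {P : ℕ → Set} → (∀ n → Dec (P n)) → ∀ {n} → P n → ∃ (Least P)
least {P} P? = <-rec _ minimise _
  where
  minimise : ∀ n → (∀ {m} → m < n → P m → ∃ (Least P)) → P n → ∃ (Least P)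
  minimise n below pn with anyUpTo? P? n
  ... | yes (m , m<n , pm) = below m<n pm
  ... | no ∄smaller        = n , pn , λ j pj → ≮⇒≥ (λ j<n → ∄smaller (j , j<n , pj))

χtd-exists : ∀ {G k} → DecidableGraph G → ProperTDL G k → ∃ λ d → IsChiTd G d × d ≤ k
χtd-exists {k = k} D F with least (properTDL? D) F
... | d , Fd , minimal = d , (Fd , minimal) , minimal k F

mainTheorem10 : (n : ℕ) → 3 ≤ n → (c : ℕ) → IsChiTd (K n) c →
    Σ ℕ (λ d → IsChiTd (cl (K n)) d × d ≤ 2 * c)
mainTheorem10 n 3≤n c (F , _)
  with gap-permutation (ProperTDL.f F) (labels-injective F) (ProperTDL.lower F) (≤-trans (n≤1+n 2) 3≤n)
... | π , gap =
  χtd-exists (cl-decidable (K-decidable n)) (CloneDoubling.cl-ProperTDL F (permute π F) gap)
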